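{- Let $\mathcal{C}=\{c_1,\ldots,c_m\}$ be a collection of cliques with graph union $U$ on vertex set $V$. For $H\subseteq V$, the induced subgraph $U[H]$ is connected if and only if its support $S(H)$ is path-intersecting.
   Context: A clique is identified with its vertex set. The graph union $U$ of $c_1,\ldots,c_m$ has vertex set $V=\bigcup_j c_j$, and distinct $u,v\in V$ are adjacent iff $u,v\in c_j$ for some $j$. For $J\subseteq\{1,\ldots,m\}$, $\Gamma_J$ is the set of $v\in V$ with $\{j:v\in c_j\}=J$. The support of $H\subseteq V$ is $S(H)=\{J: H\cap\Gamma_J\neq\emptyset\}$. A collection $\mathcal{F}$ of sets is path-intersecting if for any $A,B\in\mathcal{F}$ there is a sequence $A=J_1,J_2,\ldots,J_\ell=B$ of members of $\mathcal{F}$ with $J_i\cap J_{i+1}\neq\emptyset$ for all $i=1,\ldots,\ell-1$. -}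

module Defs where

open import Data.Nat using (ℕ)
open import Data.Fin using (Fin)
open import Data.Fin.Subset using (Subset; _∈_; _⊆_)
open import Data.Product using (Σ; ∃; _×_; _,_)
open import Relation.Binary.PropositionalEquality using (_≡_)
open import Relation.Nullary using (¬_)
open import Function.Bundles using (_⇔_)
open import Level using (0ℓ)

Cliques : ℕ → ℕ → Set
Cliques m n = Fin m → Subset n

module _ {m n : ℕ} (c : Cliques m n) where

  InV : Fin n → Set
  InV v = ∃ λ j → v ∈ c j

  Adj : Fin n → Fin n → Set
  Adj u v = ¬ (u ≡ v) × (∃ λ j → (u ∈ c j) × (v ∈ c j))

  data WalkIn (H : Subset n) : Fin n → Fin n → Set where
    here : ∀ {u} → u ∈ H → WalkIn H u u
    step : ∀ {u w v} → u ∈ H → Adj u w → WalkIn H w v → WalkIn H u v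

  Connected : Subset n → Set
  Connected H = ∀ u v → u ∈ H → v ∈ H → WalkIn H u v

  InΓ : Subset m → Fin n → Set
  InΓ J v = ∀ j → (j ∈ J ⇔ v ∈ c j)

  Support : Subset n → Subset m → Set
  Support H J = ∃ λ v → v ∈ H × InΓ J v

Family : ℕ → Set₁
Family m = Subset m → Set

Meets : ∀ {m} → Subset m → Subset m → Set
Meets A B = ∃ λ j → j ∈ A × j ∈ B

data ChainIn {m : ℕ} (F : Family m) : Subset m → Subset m → Set where
  done : ∀ {A} → F A → ChainIn F A A
  step : ∀ {A A′ B} → F A → Meets A A′ → ChainIn F A′ B → ChainIn F A B

PathIntersecting : ∀ {m} → Family m → Set
PathIntersecting F = ∀ A B → F A → F B → ChainIn F A B

{-# OPTIONS --safe #-}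
module Submission where

-- A vertex v lies in exactly one Γ-set, namely its profile {j : v ∈ c j}.
-- An edge uw of U lies in a common clique j, so the profiles of u and w meet
-- in j; hence a walk in U[H] yields a chain of intersecting members of S(H).
-- Conversely, if the Γ-sets of w and x meet in j, then w and x both lie in
-- c j and are therefore equal or adjacent, so a chain in S(H) yields a walk.
-- The chain of length one needs the vertex to lie in some clique, which is
-- why H ⊆ V is assumed.

open import Defs
open import Data.Nat using (ℕ)
open import Data.Fin using (Fin; _≟_)
open import Data.Fin.Subset using (Subset; Side; inside; _∈_)
open import Data.Fin.Subset.Properties using (⊆-antisym)
open import Data.Product using (_,_)
open import Data.Vec using (tabulate; lookup)
open import Data.Vec.Properties using ([]=⇒lookup; lookup⇒[]=; lookup∘tabulate)
open import Function.Bundles using (_⇔_; mk⇔; Equivalence)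
open import Function.Properties.Equivalence using () renaming (trans to ⇔-trans)
open import Relation.Binary.PropositionalEquality using (_≡_; refl; sym; trans)
open import Relation.Nullary using (yes; no)

open Equivalence using (to; from)

∈-tabulate : ∀ {k} (f : Fin k → Side) j → j ∈ tabulate f ⇔ f j ≡ inside
∈-tabulate f j = mk⇔
  (λ j∈ → trans (sym (lookup∘tabulate f j)) ([]=⇒lookup j∈))
  (λ fj → lookup⇒[]= j (tabulate f) (trans (lookup∘tabulate f j) fj))

ChainIn-head : ∀ {m} {F : Family m} {A B} → ChainIn F A B → F A
ChainIn-head (done FA)     = FA
ChainIn-head (step FA _ _) = FA

module _ {m n : ℕ} (c : Cliques m n) where

  profile : Fin n → Subset m
  profile v = tabulate (λ j → lookup (c j) v)

  InΓ-profile : ∀ v → InΓ c (profile v) v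
  InΓ-profile v j = ⇔-trans (∈-tabulate _ j)
    (mk⇔ (lookup⇒[]= v (c j)) []=⇒lookup)

  InΓ-unique : ∀ {A B v} → InΓ c A v → InΓ c B v → A ≡ B
  InΓ-unique ΓA ΓB = ⊆-antisym (λ {j} j∈A → from (ΓB j) (to (ΓA j) j∈A))
                               (λ {j} j∈B → from (ΓA j) (to (ΓB j) j∈B))

  module _ (H : Subset n) where

    walk-via-clique : ∀ {w x v j} → w ∈ H → w ∈ c j → x ∈ c j →
                      WalkIn c H x v → WalkIn c H w v
    walk-via-clique {w} {x} {j = j} w∈H w∈j x∈j walk with w ≟ x
    ... | yes refl = walk
    ... | no w≢x   = step w∈H (w≢x , j , w∈j , x∈j) walk

    walk⇒chain : ∀ {u v A B} → WalkIn c H u v →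
                 InΓ c A u → InΓ c B v → ChainIn (Support c H) A B
    walk⇒chain (here u∈H) ΓA ΓB with InΓ-unique ΓA ΓB
    ... | refl = done (_ , u∈H , ΓA)
    walk⇒chain {u} (step {w = w} u∈H (_ , j , u∈j , w∈j) walk) ΓA ΓB =
      step (u , u∈H , ΓA) (j , from (ΓA j) u∈j , from (InΓ-profile w j) w∈j)
           (walk⇒chain walk (InΓ-profile w) ΓB)

    chain⇒walk : (∀ v → v ∈ H → InV c v) → ∀ {A B w v} →
                 ChainIn (Support c H) A B →
                 w ∈ H → InΓ c A w → v ∈ H → InΓ c B v → WalkIn c H w v
    chain⇒walk H⊆V {v = v} (done _) w∈H Γw v∈H Γv with H⊆V v v∈H
    ... | j , v∈j = walk-via-clique w∈H (to (Γw j) (from (Γv j) v∈j)) v∈j (here v∈H)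
    chain⇒walk H⊆V (step _ (j , j∈A , j∈A′) chain) w∈H Γw v∈H Γv
      with ChainIn-head chain
    ... | x , x∈H , Γx = walk-via-clique w∈H (to (Γw j) j∈A) (to (Γx j) j∈A′)
                           (chain⇒walk H⊆V chain x∈H Γx v∈H Γv)

proposition4p9 : (m n : ℕ) (c : Cliques m n) (H : Subset n) →
    (∀ v → v ∈ H → InV c v) →
    (Connected c H ⇔ PathIntersecting (Support c H))
proposition4p9 m n c H H⊆V = mk⇔ connected⇒pathIntersecting pathIntersecting⇒connected
  where
  connected⇒pathIntersecting : Connected c H → PathIntersecting (Support c H)
  connected⇒pathIntersecting conn A B (u , u∈H , ΓA) (v , v∈H , ΓB) =
    walk⇒chain c H (conn u v u∈H v∈H) ΓA ΓB

  pathIntersecting⇒connected : PathIntersecting (Support c H) → Connected c H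
  pathIntersecting⇒connected pi u v u∈H v∈H =
    chain⇒walk c H H⊆V
      (pi (profile c u) (profile c v) (u , u∈H , InΓ-profile c u) (v , v∈H , InΓ-profile c v))
      u∈H (InΓ-profile c u) v∈H (InΓ-profile c v)
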